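{- For all integers $m,n\ge 1$, $\chi_{la}(P_{2m}\vee K_{2n})=2n+2$.
   Context: For a connected graph $H=(V,E)$, a local antimagic labeling is a bijection $f:E\to\{1,\dots,|E|\}$ such that $f^+(x)\neq f^+(y)$ for every pair of adjacent vertices $x,y$, where $f^+(x)=\sum_{e\in E(x)}f(e)$ is the sum of labels of edges incident to $x$. The local antimagic chromatic number $\chi_{la}(H)$ is the minimum number of distinct values of $f^+$ over all local antimagic labelings $f$ of $H$. $P_k$ is the path of order $k$, $K_k$ is the complete graph of order $k$, and $G\vee H$ is the join of $G$ and $H$ (disjoint union plus all edges between $V(G)$ and $V(H)$). -}

module Defs where

open import Data.Bool using (Bool; true; false; _∧_; _∨_; not)
open import Data.Nat using (ℕ; zero; suc; _+_; _*_; _≤_; _<ᵇ_; _≡ᵇ_)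
import Data.Nat as ℕ
open import Data.Fin using (Fin; toℕ; splitAt)
open import Data.Nat.ListAction using (sum)
open import Data.List using (List; _∷_; []; map; length; filterᵇ; allFin; concatMap; lookup; deduplicate)
open import Data.Product using (_×_; _,_; proj₁; proj₂; ∃; Σ)
open import Data.Sum using (inj₁; inj₂)
open import Function.Definitions using (Bijective)
open import Relation.Binary.PropositionalEquality using (_≡_; _≢_)

-- A finite simple graph on vertex set Fin nv, given by a (symmetric,
-- irreflexive) Boolean adjacency relation.
record Graph : Set where
  field
    nv  : ℕ
    adj : Fin nv → Fin nv → Bool
open Graph public

-- The edge set: unordered pairs {i,j}, represented once as (i , j) with i < j.
edges : (G : Graph) → List (Fin (nv G) × Fin (nv G))
edges G = filterᵇ (λ p → (toℕ (proj₁ p) <ᵇ toℕ (proj₂ p)) ∧ adj G (proj₁ p) (proj₂ p))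
                  (concatMap (λ i → map (λ j → (i , j)) (allFin (nv G))) (allFin (nv G)))

ne : Graph → ℕ
ne G = length (edges G)

edge : (G : Graph) → Fin (ne G) → Fin (nv G) × Fin (nv G)
edge G e = lookup (edges G) e

-- An edge labeling is a bijection from the edges to {1,…,|E|};
-- edges are indexed by Fin (ne G) and label value of e is 1 + toℕ (f e).
Labeling : Graph → Set
Labeling G = Σ (Fin (ne G) → Fin (ne G)) (Bijective _≡_ _≡_)

label : (G : Graph) → Labeling G → Fin (ne G) → ℕ
label G f e = suc (toℕ (proj₁ f e))

isEndpoint : {k : ℕ} → Fin k → Fin k × Fin k → Bool
isEndpoint x (i , j) = (toℕ x ≡ᵇ toℕ i) ∨ (toℕ x ≡ᵇ toℕ j)

vsum : (G : Graph) → Labeling G → Fin (nv G) → ℕ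
vsum G f x = sum (map (λ e → label G f e) (filterᵇ (λ e → isEndpoint x (edge G e)) (allFin (ne G))))

IsLocalAntimagic : (G : Graph) → Labeling G → Set
IsLocalAntimagic G f = ∀ x y → adj G x y ≡ true → vsum G f x ≢ vsum G f y

numColors : (G : Graph) → Labeling G → ℕ
numColors G f = length (deduplicate ℕ._≟_ (map (vsum G f) (allFin (nv G))))

ChiLaEq : Graph → ℕ → Set
ChiLaEq G k =
  (Σ (Labeling G) λ f → IsLocalAntimagic G f × numColors G f ≡ k)
  × (∀ (f : Labeling G) → IsLocalAntimagic G f → k ≤ numColors G f)

pathAdj : {p : ℕ} → Fin p → Fin p → Bool
pathAdj i j = (suc (toℕ i) ≡ᵇ toℕ j) ∨ (suc (toℕ j) ≡ᵇ toℕ i)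

completeAdj : {q : ℕ} → Fin q → Fin q → Bool
completeAdj i j = not (toℕ i ≡ᵇ toℕ j)

-- P_p ∨ K_q on vertex set Fin (p + q): first p vertices form the path,
-- last q the clique, and every path vertex is joined to every clique vertex.
PathJoinComplete : ℕ → ℕ → Graph
PathJoinComplete p q = record { nv = p + q ; adj = a }
  where
    a : Fin (p + q) → Fin (p + q) → Bool
    a x y with splitAt p x | splitAt p y
    ... | inj₁ i | inj₁ j = pathAdj i j
    ... | inj₂ i | inj₂ j = completeAdj i j
    ... | inj₁ _ | inj₂ _ = true
    ... | inj₂ _ | inj₁ _ = true

-- Two adjacent path vertices together with the q clique vertices are pairwise adjacent, so every
-- local antimagic labeling of P_p ∨ K_q has at least q + 2 vertex sums.  For a labeling attaining
-- q + 2 (p = 2k + 2, q = 2l + 2), path edges get the smallest labels, join edges the middle block and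
-- clique edges the largest.  The join edges at clique vertex a get p (1 + a) + σ_a(i) for permutations
-- σ_a of [0, p); hence the clique sums increase strictly with a and exceed every path sum.  Taking for
-- σ_a the identity, a shift of the even positions, and l pairs (identity, reversal) makes the sum at
-- path vertex i depend only on the parity of i.

module Submission where

open import Defs
open import Data.Nat using (ℕ; _+_; _*_; _≥_)

open import Data.Bool using (Bool; true; false; T; if_then_else_; _∧_; _∨_; not)
open import Data.Bool.Properties using (T?; T-≡; T-∧; T-∨; ∨-comm)
open import Data.Empty using (⊥; ⊥-elim)
open import Data.Unit using (tt)
open import Data.Fin as Fin using (Fin; toℕ; splitAt)
import Data.Fin.Properties as Finₚ
open import Data.List
  using (List; []; _∷_; _++_; map; filterᵇ; allFin; concatMap; length; lookup; tabulate; deduplicate; cartesianProduct)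
import Data.List.Properties as Listₚ
open import Data.List.Membership.Propositional using (_∈_)
open import Data.List.Membership.Propositional.Properties
  using (∈-lookup; ∈-filter⁻; ∈-deduplicate⁺; ∈-deduplicate⁻; ∈-map⁺; ∈-map⁻; ∈-allFin)
open import Data.List.Relation.Binary.Subset.Propositional using (_⊆_)
open import Data.List.Relation.Unary.All as All using (All)
open import Data.List.Relation.Unary.AllPairs as AllPairs using (AllPairs; []; _∷_)
import Data.List.Relation.Unary.AllPairs.Properties as AllPairsₚ
import Data.List.Relation.Unary.All.Properties as Allₚ
open import Data.List.Relation.Unary.Any as Any using (here; there)
import Data.List.Relation.Unary.Any.Properties as Anyₚ
open import Data.List.Relation.Unary.Unique.Propositional using (Unique)
import Data.List.Relation.Unary.Unique.Propositional.Properties as Uniqueₚ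
import Data.List.Relation.Unary.Unique.DecPropositional.Properties as DecUniqueₚ
open import Data.Nat as ℕ using (zero; suc; pred; parity; _∸_; _≤_; _<_; _≡ᵇ_; _<ᵇ_; z≤n; s≤s; z<s; _<?_)
open import Data.Nat.Properties
open import Data.Nat.Tactic.RingSolver using (solve-∀)
open import Data.Nat.ListAction using () renaming (sum to listSum)
open import Data.Nat.ListAction.Properties using (sum-++)
open import Data.Parity.Base as ℙ using (Parity; 0ℙ; 1ℙ)
import Data.Parity.Properties as Parityₚ
open import Data.Product using (Σ; _×_; _,_; proj₁; proj₂)
open import Data.Sum using (_⊎_; inj₁; inj₂)
import Data.Sum as Sum
open import Function using (_∘_; id)
open import Function.Bundles using (Equivalence)
open import Function.Definitions using (Injective; Surjective; Bijective)
open import Relation.Binary.PropositionalEquality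
open import Relation.Nullary using (yes; no)
open import Relation.Binary.Definitions using (tri<; tri≈; tri>)

open import Algebra.Properties.Semiring.Sum +-*-semiring
  using (sum; sum-syntax; ∑-distrib-+; ∑-comm; sum-cong-≗; *-distribˡ-sum)

<ᵇ-true : ∀ {m n} → m < n → (m <ᵇ n) ≡ true
<ᵇ-true m<n = Equivalence.to T-≡ (<⇒<ᵇ m<n)

<ᵇ-false : ∀ {m n} → n ≤ m → (m <ᵇ n) ≡ false
<ᵇ-false {m}     {zero}  _         = refl
<ᵇ-false {suc m} {suc n} (s≤s n≤m) = <ᵇ-false n≤m

≡ᵇ-sym : ∀ m n → (m ≡ᵇ n) ≡ (n ≡ᵇ m)
≡ᵇ-sym zero    zero    = refl
≡ᵇ-sym zero    (suc n) = refl
≡ᵇ-sym (suc m) zero    = refl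
≡ᵇ-sym (suc m) (suc n) = ≡ᵇ-sym m n

≡ᵇ-refl : ∀ n → (n ≡ᵇ n) ≡ true
≡ᵇ-refl n = Equivalence.to T-≡ (≡⇒≡ᵇ n n refl)

≡ᵇ-false : ∀ {m n} → m ≢ n → (m ≡ᵇ n) ≡ false
≡ᵇ-false {m} {n} m≢n with m ≡ᵇ n in eq
... | true  = ⊥-elim (m≢n (≡ᵇ⇒≡ m n (subst T (sym eq) _)))
... | false = refl

suc-<ᵇ : ∀ m n → (suc m <ᵇ n) ≡ (m <ᵇ pred n)
suc-<ᵇ m zero    = refl
suc-<ᵇ m (suc n) = refl

+-<ᵇ : ∀ k m n → (k + m <ᵇ k + n) ≡ (m <ᵇ n)
+-<ᵇ zero    m n = refl
+-<ᵇ (suc k) m n = +-<ᵇ k m n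

<ᵇ∧≢ᵇ : ∀ m n → ((m <ᵇ n) ∧ not (m ≡ᵇ n)) ≡ (m <ᵇ n)
<ᵇ∧≢ᵇ zero    zero    = refl
<ᵇ∧≢ᵇ zero    (suc n) = refl
<ᵇ∧≢ᵇ (suc m) zero    = refl
<ᵇ∧≢ᵇ (suc m) (suc n) = <ᵇ∧≢ᵇ m n

<ᵇ∧adjacent : ∀ m n → ((m <ᵇ n) ∧ ((suc m ≡ᵇ n) ∨ (suc n ≡ᵇ m))) ≡ (suc m ≡ᵇ n)
<ᵇ∧adjacent zero    zero    = refl
<ᵇ∧adjacent zero    (suc n) = ∨-comm (zero ≡ᵇ n) false
<ᵇ∧adjacent (suc m) zero    = refl
<ᵇ∧adjacent (suc m) (suc n) = <ᵇ∧adjacent m n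

parity-suc≢ : ∀ n → parity (suc n) ≢ parity n
parity-suc≢ n eq = Parityₚ.p≢p⁻¹ (parity n) (trans (sym (Parityₚ.suc-homo-⁻¹ n)) (cong ℙ._⁻¹ eq))

if-∨-split : ∀ (e a b : Bool) (l : ℕ) → (T e → T a → T b → ⊥) →
  (if e then (if a ∨ b then l else 0) else 0)
    ≡ (if a then (if e then l else 0) else 0) + (if b then (if e then l else 0) else 0)
if-∨-split true  true  true  l not-both = ⊥-elim (not-both _ _ _)
if-∨-split true  true  false l _        = sym (+-identityʳ l)
if-∨-split true  false true  l _        = refl
if-∨-split true  false false l _        = refl
if-∨-split false true  true  l _        = refl
if-∨-split false true  false l _        = refl
if-∨-split false false true  l _        = refl
if-∨-split false false false l _        = refl

if-not+if : ∀ b x → (if not b then x else 0) + (if b then x else 0) ≡ x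
if-not+if true  x = refl
if-not+if false x = +-identityʳ x

if-if-mono : ∀ x y {u v} → u ≤ v →
             (if x then (if y then u else 0) else 0) ≤ (if y then (if x then v else 0) else 0)
if-if-mono true  true  u≤v = u≤v
if-if-mono true  false _   = z≤n
if-if-mono false true  _   = z≤n
if-if-mono false false _   = z≤n

-- Finite sums

∑-const : ∀ n c → ∑[ i < n ] c ≡ n * c
∑-const zero    c = refl
∑-const (suc n) c = cong (c +_) (∑-const n c)

∑-mono-≤ : ∀ {n} {f g : Fin n → ℕ} → (∀ i → f i ≤ g i) → sum f ≤ sum g
∑-mono-≤ {zero}  f≤g = z≤n
∑-mono-≤ {suc n} f≤g = +-mono-≤ (f≤g Fin.zero) (∑-mono-≤ (f≤g ∘ Fin.suc))

∑-if : ∀ {n} (b : Bool) (g : Fin n → ℕ) → ∑[ i < n ] (if b then g i else 0) ≡ (if b then sum g else 0)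
∑-if         true  g = refl
∑-if {n = n} false g = trans (∑-const n 0) (*-zeroʳ n)

∑-δ : ∀ {n} c (g : ℕ → ℕ) →
      ∑[ j < n ] (if c ≡ᵇ toℕ j then g (toℕ j) else 0) ≡ (if c <ᵇ n then g c else 0)
∑-δ {zero}  c       g = refl
∑-δ {suc n} zero    g = trans (cong (g 0 +_) (∑-if {n} false (g ∘ suc ∘ toℕ))) (+-identityʳ (g 0))
∑-δ {suc n} (suc c) g = ∑-δ {n} c (g ∘ suc)

∑-δᶠ : ∀ {n} (k : Fin n) (g : Fin n → ℕ) → ∑[ j < n ] (if toℕ k ≡ᵇ toℕ j then g j else 0) ≡ g k
∑-δᶠ {suc n} Fin.zero    g = trans (cong (g Fin.zero +_) (∑-if {n} false (g ∘ Fin.suc))) (+-identityʳ _)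
∑-δᶠ {suc n} (Fin.suc k) g = ∑-δᶠ k (g ∘ Fin.suc)

∑-remove : ∀ {n} (k : Fin n) (g : Fin n → ℕ) →
           ∑[ c < n ] (if not (toℕ k ≡ᵇ toℕ c) then g c else 0) + g k ≡ sum g
∑-remove {n} k g =
  trans (cong (∑[ c < n ] (if not (toℕ k ≡ᵇ toℕ c) then g c else 0) +_) (sym (∑-δᶠ k g)))
  (trans (sym (∑-distrib-+ {n} _ _)) (sum-cong-≗ {n} (λ c → if-not+if (toℕ k ≡ᵇ toℕ c) (g c))))

∑-splitAt : ∀ p {q} (g : Fin p ⊎ Fin q → ℕ) →
            ∑[ x < p + q ] g (splitAt p x) ≡ ∑[ i < p ] g (inj₁ i) + ∑[ a < q ] g (inj₂ a)
∑-splitAt zero    g = refl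
∑-splitAt (suc p) g = trans (cong (g (inj₁ Fin.zero) +_) (∑-splitAt p (g ∘ Sum.map Fin.suc id)))
                            (sym (+-assoc (g (inj₁ Fin.zero)) _ _))

∑-<ᵇ : ∀ {n} c → c ≤ n → ∑[ a < n ] (if toℕ a <ᵇ c then 1 else 0) ≡ c
∑-<ᵇ {zero}  zero    _         = refl
∑-<ᵇ {suc n} zero    _         = ∑-if {n} false (λ _ → 1)
∑-<ᵇ {suc n} (suc c) (s≤s c≤n) = cong suc (∑-<ᵇ c c≤n)

-- Triangular numbers and pairings

triangle : ℕ → ℕ
triangle zero    = 0
triangle (suc n) = triangle n + n

∑-toℕ : ∀ n → ∑[ a < n ] toℕ a ≡ triangle n
∑-toℕ zero    = refl
∑-toℕ (suc n) = begin
  ∑[ a < n ] suc (toℕ a)                    ≡⟨ sum-cong-≗ {n} (λ a → +-comm 1 (toℕ a)) ⟩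
  ∑[ a < n ] (toℕ a + 1)                    ≡⟨ ∑-distrib-+ {n} toℕ (λ _ → 1) ⟩
  ∑[ a < n ] toℕ a + ∑[ a < n ] 1           ≡⟨ cong₂ _+_ (∑-toℕ n) (trans (∑-const n 1) (*-identityʳ n)) ⟩
  triangle n + n                            ∎
  where open ≡-Reasoning

triangle-mono-≤ : ∀ {m n} → m ≤ n → triangle m ≤ triangle n
triangle-mono-≤ {zero}              _         = z≤n
triangle-mono-≤ {suc m} {suc n} (s≤s m≤n) = +-mono-≤ (triangle-mono-≤ m≤n) m≤n

triangle+<triangle : ∀ {a b n} → a < b → b < n → triangle b + a < triangle n
triangle+<triangle {b = b} a<b b<n = <-≤-trans (+-monoʳ-< (triangle b) a<b) (triangle-mono-≤ b<n)

triangle-pair-injective : ∀ {a b a′ b′} → a < b → a′ < b′ →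
                          triangle b + a ≡ triangle b′ + a′ → a ≡ a′ × b ≡ b′
triangle-pair-injective {a} {b} {a′} {b′} a<b a′<b′ eq with <-cmp b b′
... | tri< b<b′ _ _ = ⊥-elim (<-irrefl eq (<-≤-trans (triangle+<triangle a<b b<b′) (m≤m+n _ a′)))
... | tri≈ _ refl _ = +-cancelˡ-≡ (triangle b) a a′ eq , refl
... | tri> _ _ b′<b = ⊥-elim (<-irrefl (sym eq) (<-≤-trans (triangle+<triangle a′<b′ b′<b) (m≤m+n _ a)))

triangle-*2 : ∀ n → triangle (n * 2) + n ≡ n * n * 2
triangle-*2 zero    = refl
triangle-*2 (suc n) = begin
  triangle (n * 2) + n * 2 + suc (n * 2) + suc n ≡⟨ regroup (triangle (n * 2)) n ⟩
  triangle (n * 2) + n + (n * 4 + 2)             ≡⟨ cong (_+ (n * 4 + 2)) (triangle-*2 n) ⟩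
  n * n * 2 + (n * 4 + 2)                        ≡⟨ square n ⟩
  suc n * suc n * 2                              ∎
  where
  open ≡-Reasoning
  regroup : ∀ t n → t + n * 2 + suc (n * 2) + suc n ≡ t + n + (n * 4 + 2)
  regroup = solve-∀
  square : ∀ n → n * n * 2 + (n * 4 + 2) ≡ suc n * suc n * 2
  square = solve-∀

*+<*+ : ∀ n {a a′ r r′} → r < n → a < a′ → n * a + r < n * a′ + r′
*+<*+ n {a} {a′} {r} {r′} r<n a<a′ = begin-strict
  n * a + r    <⟨ +-monoʳ-< (n * a) r<n ⟩
  n * a + n    ≡⟨ trans (+-comm (n * a) n) (sym (*-suc n a)) ⟩
  n * suc a    ≤⟨ *-monoʳ-≤ n a<a′ ⟩
  n * a′       ≤⟨ m≤m+n (n * a′) r′ ⟩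
  n * a′ + r′  ∎
  where open ≤-Reasoning

*+-injective : ∀ n {a a′ r r′} → r < n → r′ < n → n * a + r ≡ n * a′ + r′ → a ≡ a′ × r ≡ r′
*+-injective n {a} {a′} r<n r′<n eq with <-cmp a a′
... | tri< a<a′ _ _ = ⊥-elim (<-irrefl eq (*+<*+ n r<n a<a′))
... | tri≈ _ refl _ = refl , +-cancelˡ-≡ (n * a) _ _ eq
... | tri> _ _ a′<a = ⊥-elim (<-irrefl (sym eq) (*+<*+ n r′<n a′<a))

sum-tabulate : ∀ {n} (g : Fin n → ℕ) → listSum (tabulate g) ≡ sum g
sum-tabulate {zero}  g = refl
sum-tabulate {suc n} g = cong (g Fin.zero +_) (sum-tabulate (g ∘ Fin.suc))

sum-map-allFin : ∀ {n} (g : Fin n → ℕ) → listSum (map g (allFin n)) ≡ sum g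
sum-map-allFin g = trans (cong listSum (Listₚ.map-tabulate id g)) (sum-tabulate g)

sum-map-filterᵇ : ∀ {A : Set} (P : A → Bool) (g : A → ℕ) xs →
  listSum (map g (filterᵇ P xs)) ≡ listSum (map (λ x → if P x then g x else 0) xs)
sum-map-filterᵇ P g []       = refl
sum-map-filterᵇ P g (x ∷ xs) with P x
... | true  = cong (g x +_) (sum-map-filterᵇ P g xs)
... | false = sum-map-filterᵇ P g xs

sum-map-pairs : ∀ {A B : Set} (xs : List A) (ys : List B) (h : A × B → ℕ) →
  listSum (map h (concatMap (λ i → map (i ,_) ys) xs))
    ≡ listSum (map (λ i → listSum (map (λ j → h (i , j)) ys)) xs)
sum-map-pairs []       ys h = refl
sum-map-pairs {A} {B} (x ∷ xs) ys h = begin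
  listSum (map h (map (x ,_) ys ++ rest))
    ≡⟨ cong listSum (Listₚ.map-++ h (map (x ,_) ys) rest) ⟩
  listSum (map h (map (x ,_) ys) ++ map h rest)
    ≡⟨ sum-++ (map h (map (x ,_) ys)) (map h rest) ⟩
  listSum (map h (map (x ,_) ys)) + listSum (map h rest)
    ≡⟨ cong₂ _+_ (cong listSum (sym (Listₚ.map-∘ ys))) (sum-map-pairs xs ys h) ⟩
  listSum (map (λ j → h (x , j)) ys) + _ ∎
  where
  open ≡-Reasoning
  rest : List (A × B)
  rest = concatMap (λ i → map (i ,_) ys) xs

length≡sum-map-1 : ∀ {A : Set} (xs : List A) → length xs ≡ listSum (map (λ _ → 1) xs)
length≡sum-map-1 []       = refl
length≡sum-map-1 (x ∷ xs) = cong suc (length≡sum-map-1 xs)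

length-map-allFin : ∀ {A : Set} {n} (g : Fin n → A) → length (map g (allFin n)) ≡ n
length-map-allFin {n = n} g = trans (Listₚ.length-map g (allFin n)) (Listₚ.length-tabulate id)

concatMap≡cartesianProduct : ∀ {A B : Set} (xs : List A) (ys : List B) →
  concatMap (λ i → map (i ,_) ys) xs ≡ cartesianProduct xs ys
concatMap≡cartesianProduct []       ys = refl
concatMap≡cartesianProduct (x ∷ xs) ys = cong (map (x ,_) ys ++_) (concatMap≡cartesianProduct xs ys)

lookup-injective : ∀ {A : Set} {xs : List A} → Unique xs → Injective _≡_ _≡_ (lookup xs)
lookup-injective {xs = x ∷ xs} (x∉xs ∷ xs!) {Fin.zero}  {Fin.zero}  eq = refl
lookup-injective {xs = x ∷ xs} (x∉xs ∷ xs!) {Fin.zero}  {Fin.suc j} eq = ⊥-elim (All.lookup x∉xs (∈-lookup j) eq)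
lookup-injective {xs = x ∷ xs} (x∉xs ∷ xs!) {Fin.suc i} {Fin.zero}  eq = ⊥-elim (All.lookup x∉xs (∈-lookup i) (sym eq))
lookup-injective {xs = x ∷ xs} (x∉xs ∷ xs!) {Fin.suc i} {Fin.suc j} eq = cong Fin.suc (lookup-injective xs! eq)

Unique⇒length≤ : ∀ {A : Set} {xs ys : List A} → Unique xs → xs ⊆ ys → length xs ≤ length ys
Unique⇒length≤ {xs = xs} {ys} xs! xs⊆ys = Finₚ.injective⇒≤ position-injective
  where
  position : Fin (length xs) → Fin (length ys)
  position i = Any.index (xs⊆ys (∈-lookup i))
  position-injective : Injective _≡_ _≡_ position
  position-injective {i} {j} eq = lookup-injective xs! (begin
    lookup xs i                             ≡⟨ Anyₚ.lookup-index (xs⊆ys (∈-lookup i)) ⟩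
    lookup ys (position i)                  ≡⟨ cong (lookup ys) eq ⟩
    lookup ys (position j)                  ≡⟨ Anyₚ.lookup-index (xs⊆ys (∈-lookup j)) ⟨
    lookup xs j                             ∎)
    where open ≡-Reasoning

injective⇒surjective : ∀ {n} (π : Fin n → Fin n) → Injective _≡_ _≡_ π → Surjective _≡_ _≡_ π
injective⇒surjective {suc n} π π-inj y with Finₚ.any? (λ x → π x Finₚ.≟ y)
... | yes (x , πx≡y) = x , λ { refl → πx≡y }
... | no  y∉im = ⊥-elim (1+n≰n (Finₚ.injective⇒≤ punched-injective))
  where
  y≢π : ∀ x → y ≢ π x
  y≢π x y≡πx = y∉im (x , sym y≡πx)
  punched : Fin (suc n) → Fin n
  punched x = Fin.punchOut (y≢π x)
  punched-injective : Injective _≡_ _≡_ punched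
  punched-injective eq = π-inj (Finₚ.punchOut-injective (y≢π _) (y≢π _) eq)

permutation-from-injection : ∀ {n} (ℓ : Fin n → ℕ) → (∀ e → 0 < ℓ e) → (∀ e → ℓ e ≤ n) →
  Injective _≡_ _≡_ ℓ → Σ (Fin n → Fin n) λ π → Bijective _≡_ _≡_ π × (∀ e → suc (toℕ (π e)) ≡ ℓ e)
permutation-from-injection {n} ℓ ℓ>0 ℓ≤n ℓ-inj = π , (π-inj , injective⇒surjective π π-inj) , suc-π
  where
  suc-pred-ℓ : ∀ e → suc (pred (ℓ e)) ≡ ℓ e
  suc-pred-ℓ e = suc-pred (ℓ e) {{ℕ.>-nonZero (ℓ>0 e)}}
  π : Fin n → Fin n
  π e = Fin.fromℕ< (subst (_≤ n) (sym (suc-pred-ℓ e)) (ℓ≤n e))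
  suc-π : ∀ e → suc (toℕ (π e)) ≡ ℓ e
  suc-π e = trans (cong suc (Finₚ.toℕ-fromℕ< _)) (suc-pred-ℓ e)
  π-inj : Injective _≡_ _≡_ π
  π-inj {e} {e′} eq = ℓ-inj (trans (sym (suc-π e)) (trans (cong (suc ∘ toℕ) eq) (suc-π e′)))

-- Vertex sums and colour counts of a graph

module _ (G : Graph) where

  isOrderedEdge : Fin (nv G) → Fin (nv G) → Bool
  isOrderedEdge x y = (toℕ x <ᵇ toℕ y) ∧ adj G x y

  private
    pairs : List (Fin (nv G) × Fin (nv G))
    pairs = concatMap (λ i → map (i ,_) (allFin (nv G))) (allFin (nv G))

  sum-edges : (h : Fin (nv G) × Fin (nv G) → ℕ) →
    listSum (map h (edges G))
      ≡ ∑[ x < nv G ] ∑[ y < nv G ] (if isOrderedEdge x y then h (x , y) else 0)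
  sum-edges h =
    trans (sum-map-filterᵇ _ h pairs)
    (trans (sum-map-pairs (allFin (nv G)) (allFin (nv G)) _)
    (trans (sum-map-allFin {nv G} _) (sum-cong-≗ {nv G} (λ x → sum-map-allFin {nv G} _))))

  ne≡∑ : ne G ≡ ∑[ x < nv G ] ∑[ y < nv G ] (if isOrderedEdge x y then 1 else 0)
  ne≡∑ = trans (length≡sum-map-1 (edges G)) (sum-edges (λ _ → 1))

  edges-unique : Unique (edges G)
  edges-unique = Uniqueₚ.filter⁺ (T? ∘ _)
    (subst Unique (sym (concatMap≡cartesianProduct (allFin (nv G)) (allFin (nv G))))
      (Uniqueₚ.cartesianProduct⁺ (Uniqueₚ.allFin⁺ (nv G)) (Uniqueₚ.allFin⁺ (nv G))))

  edge-injective : Injective _≡_ _≡_ (edge G)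
  edge-injective = lookup-injective edges-unique

  edge-isOrderedEdge : ∀ e → T (isOrderedEdge (proj₁ (edge G e)) (proj₂ (edge G e)))
  edge-isOrderedEdge e = proj₂ (∈-filter⁻ (T? ∘ _) {xs = pairs} (∈-lookup e))

  map-edge-allFin : map (edge G) (allFin (ne G)) ≡ edges G
  map-edge-allFin = trans (Listₚ.map-tabulate id (edge G)) (Listₚ.tabulate-lookup (edges G))

  vsum≡incident : (f : Labeling G) (L : Fin (nv G) → Fin (nv G) → ℕ) →
    (∀ e → label G f e ≡ L (proj₁ (edge G e)) (proj₂ (edge G e))) → ∀ x →
    vsum G f x ≡ ∑[ y < nv G ] (if isOrderedEdge x y then L x y else 0)
               + ∑[ y < nv G ] (if isOrderedEdge y x then L y x else 0)
  vsum≡incident f L f≡L x = begin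
    vsum G f x
      ≡⟨ sum-map-filterᵇ _ (label G f) (allFin (ne G)) ⟩
    listSum (map (λ e → if isEndpoint x (edge G e) then label G f e else 0) (allFin (ne G)))
      ≡⟨ cong listSum (Listₚ.map-cong (λ e → cong (λ l → if isEndpoint x (edge G e) then l else 0) (f≡L e))
                                      (allFin (ne G))) ⟩
    listSum (map (incident ∘ edge G) (allFin (ne G)))
      ≡⟨ cong listSum (trans (Listₚ.map-∘ (allFin (ne G))) (cong (map incident) map-edge-allFin)) ⟩
    listSum (map incident (edges G))
      ≡⟨ sum-edges incident ⟩
    ∑[ i < V ] ∑[ j < V ] (if isOrderedEdge i j then incident (i , j) else 0)
      ≡⟨ sum-cong-≗ {V} (λ i → trans (sum-cong-≗ {V} (λ j → if-∨-split _ _ _ _ (distinct i j))) (∑-distrib-+ {V} _ _)) ⟩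
    ∑[ i < V ] (∑[ j < V ] (if x ≡ᶠ i then out i j else 0) + ∑[ j < V ] (if x ≡ᶠ j then out i j else 0))
      ≡⟨ ∑-distrib-+ {V} _ _ ⟩
    ∑[ i < V ] ∑[ j < V ] (if x ≡ᶠ i then out i j else 0) + ∑[ i < V ] ∑[ j < V ] (if x ≡ᶠ j then out i j else 0)
      ≡⟨ cong₂ _+_ (trans (sum-cong-≗ {V} (λ i → ∑-if (x ≡ᶠ i) (out i))) (∑-δᶠ x (sum ∘ out)))
                   (sum-cong-≗ {V} (λ i → ∑-δᶠ x (out i))) ⟩
    sum (out x) + ∑[ i < V ] out i x ∎
    where
    open ≡-Reasoning
    V : ℕ
    V = nv G
    _≡ᶠ_ : Fin (nv G) → Fin (nv G) → Bool
    y ≡ᶠ z = toℕ y ≡ᵇ toℕ z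
    incident : Fin (nv G) × Fin (nv G) → ℕ
    incident (i , j) = if isEndpoint x (i , j) then L i j else 0
    out : Fin (nv G) → Fin (nv G) → ℕ
    out i j = if isOrderedEdge i j then L i j else 0
    distinct : ∀ i j → T (isOrderedEdge i j) → T (x ≡ᶠ i) → T (x ≡ᶠ j) → ⊥
    distinct i j ij x≡i x≡j = <-irrefl
      (trans (sym (≡ᵇ⇒≡ (toℕ x) (toℕ i) x≡i)) (≡ᵇ⇒≡ (toℕ x) (toℕ j) x≡j))
      (<ᵇ⇒< (toℕ i) (toℕ j) (proj₁ (Equivalence.to T-∧ ij)))

  module _ (adj-sym : ∀ x y → adj G x y ≡ adj G y x) (adj-irrefl : ∀ x → adj G x x ≡ false) where

    vsum≡∑-neighbours : (f : Labeling G) (L : Fin (nv G) → Fin (nv G) → ℕ) → (∀ x y → L x y ≡ L y x) →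
      (∀ e → label G f e ≡ L (proj₁ (edge G e)) (proj₂ (edge G e))) → ∀ x →
      vsum G f x ≡ ∑[ y < nv G ] (if adj G x y then L x y else 0)
    vsum≡∑-neighbours f L L-sym f≡L x =
      trans (vsum≡incident f L f≡L x) (trans (sym (∑-distrib-+ {nv G} _ _)) (sum-cong-≗ {nv G} one-orientation))
      where
      one-orientation : ∀ y → (if isOrderedEdge x y then L x y else 0) + (if isOrderedEdge y x then L y x else 0)
                              ≡ (if adj G x y then L x y else 0)
      one-orientation y with <-cmp (toℕ x) (toℕ y)
      ... | tri< x<y _ _ rewrite <ᵇ-true x<y | <ᵇ-false (<⇒≤ x<y) = +-identityʳ _
      ... | tri> _ _ y<x rewrite <ᵇ-false (<⇒≤ y<x) | <ᵇ-true y<x | adj-sym y x | L-sym y x = refl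
      ... | tri≈ _ x≡y _ rewrite Finₚ.toℕ-injective x≡y | <ᵇ-false (≤-refl {toℕ y}) | adj-irrefl y = refl

  labeling-from-injection : (ℓ : Fin (ne G) → ℕ) → (∀ e → 0 < ℓ e) → (∀ e → ℓ e ≤ ne G) →
    Injective _≡_ _≡_ ℓ → Σ (Labeling G) λ f → ∀ e → label G f e ≡ ℓ e
  labeling-from-injection ℓ ℓ>0 ℓ≤ne ℓ-inj =
    let (π , π-bij , suc-π) = permutation-from-injection ℓ ℓ>0 ℓ≤ne ℓ-inj in (π , π-bij) , suc-π

  numColors≤ : (f : Labeling G) (cs : List ℕ) → (∀ x → vsum G f x ∈ cs) → numColors G f ≤ length cs
  numColors≤ f cs vsum∈cs = Unique⇒length≤ (DecUniqueₚ.deduplicate-! ℕ._≟_ _) colours⊆cs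
    where
    colours⊆cs : deduplicate ℕ._≟_ (map (vsum G f) (allFin (nv G))) ⊆ cs
    colours⊆cs c∈ with ∈-map⁻ (vsum G f) (∈-deduplicate⁻ ℕ._≟_ _ c∈)
    ... | x , _ , refl = vsum∈cs x

  clique≤numColors : (f : Labeling G) → IsLocalAntimagic G f →
    (vs : List (Fin (nv G))) → AllPairs (λ x y → adj G x y ≡ true) vs → length vs ≤ numColors G f
  clique≤numColors f f-antimagic vs vs-clique =
    subst (_≤ numColors G f) (Listₚ.length-map (vsum G f) vs) (Unique⇒length≤ sums-unique sums⊆colours)
    where
    sums-unique : Unique (map (vsum G f) vs)
    sums-unique = AllPairsₚ.map⁺ (AllPairs.map (f-antimagic _ _) vs-clique)
    sums⊆colours : map (vsum G f) vs ⊆ deduplicate ℕ._≟_ (map (vsum G f) (allFin (nv G)))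
    sums⊆colours c∈ with ∈-map⁻ (vsum G f) c∈
    ... | x , _ , refl = ∈-deduplicate⁺ ℕ._≟_ (∈-map⁺ (vsum G f) (∈-allFin x))

-- The join P_p ∨ K_q

module Join (p q : ℕ) where

  G : Graph
  G = PathJoinComplete p q

  Node : Set
  Node = Fin p ⊎ Fin q

  pattern path i   = inj₁ i
  pattern clique a = inj₂ a

  vertex : Node → Fin (p + q)
  vertex = Fin.join p q

  joinAdj : Node → Node → Bool
  joinAdj (path i)   (path j)   = pathAdj i j
  joinAdj (clique a) (clique b) = completeAdj a b
  joinAdj (path _)   (clique _) = true
  joinAdj (clique _) (path _)   = true

  adj≡joinAdj : ∀ x y → adj G x y ≡ joinAdj (splitAt p x) (splitAt p y)
  adj≡joinAdj x y with splitAt p x | splitAt p y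
  ... | path i   | path j   = refl
  ... | path i   | clique b = refl
  ... | clique a | path j   = refl
  ... | clique a | clique b = refl

  adj-vertex : ∀ u v → adj G (vertex u) (vertex v) ≡ joinAdj u v
  adj-vertex u v = trans (adj≡joinAdj (vertex u) (vertex v))
                         (cong₂ joinAdj (Finₚ.splitAt-join p q u) (Finₚ.splitAt-join p q v))

  joinAdj-sym : ∀ u v → joinAdj u v ≡ joinAdj v u
  joinAdj-sym (path i)   (path j)   = ∨-comm (suc (toℕ i) ≡ᵇ toℕ j) (suc (toℕ j) ≡ᵇ toℕ i)
  joinAdj-sym (clique a) (clique b) = cong not (≡ᵇ-sym (toℕ a) (toℕ b))
  joinAdj-sym (path _)   (clique _) = refl
  joinAdj-sym (clique _) (path _)   = refl

  joinAdj-irrefl : ∀ u → joinAdj u u ≡ false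
  joinAdj-irrefl (path i)   rewrite ≡ᵇ-false (1+n≢n {toℕ i}) = refl
  joinAdj-irrefl (clique a) rewrite ≡ᵇ-refl (toℕ a) = refl

  adj-sym : ∀ x y → adj G x y ≡ adj G y x
  adj-sym x y = trans (adj≡joinAdj x y) (trans (joinAdj-sym (splitAt p x) (splitAt p y)) (sym (adj≡joinAdj y x)))

  adj-irrefl : ∀ x → adj G x x ≡ false
  adj-irrefl x = trans (adj≡joinAdj x x) (joinAdj-irrefl (splitAt p x))

  index : Node → ℕ
  index (path i)   = toℕ i
  index (clique a) = p + toℕ a

  toℕ≡index : ∀ x → toℕ x ≡ index (splitAt p x)
  toℕ≡index x = subst (λ z → toℕ z ≡ index (splitAt p z)) (Finₚ.join-splitAt p q x) (toℕ-vertex (splitAt p x))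
    where
    toℕ-vertex : ∀ u → toℕ (vertex u) ≡ index (splitAt p (vertex u))
    toℕ-vertex (path i)   rewrite Finₚ.splitAt-↑ˡ p i q = Finₚ.toℕ-↑ˡ i q
    toℕ-vertex (clique a) rewrite Finₚ.splitAt-↑ʳ p q a = Finₚ.toℕ-↑ʳ p a

  isOrderedJoinEdge : Node → Node → Bool
  isOrderedJoinEdge u v = (index u <ᵇ index v) ∧ joinAdj u v

  isOrderedEdge≡ : ∀ x y → isOrderedEdge G x y ≡ isOrderedJoinEdge (splitAt p x) (splitAt p y)
  isOrderedEdge≡ x y rewrite toℕ≡index x | toℕ≡index y | adj≡joinAdj x y = refl

  data OrderedEdge : Node → Node → Set where
    path-edge   : ∀ i j → toℕ j ≡ suc (toℕ i) → OrderedEdge (path i) (path j)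
    join-edge   : ∀ i a → OrderedEdge (path i) (clique a)
    clique-edge : ∀ a b → toℕ a < toℕ b → OrderedEdge (clique a) (clique b)

  classify : ∀ u v → T (isOrderedJoinEdge u v) → OrderedEdge u v
  classify (path i) (path j) e with Equivalence.to T-∧ e
  ... | i<j , ij-adj with Equivalence.to T-∨ ij-adj
  ...   | inj₁ j≡1+i = path-edge i j (sym (≡ᵇ⇒≡ _ _ j≡1+i))
  ...   | inj₂ i≡1+j = ⊥-elim (<-asym (<ᵇ⇒< (toℕ i) (toℕ j) i<j)
                                       (subst (toℕ j <_) (≡ᵇ⇒≡ _ _ i≡1+j) ≤-refl))
  classify (path i)   (clique a) _ = join-edge i a
  classify (clique a) (path i)   e = ⊥-elim (<-asym (<ᵇ⇒< _ _ (proj₁ (Equivalence.to T-∧ e)))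
                                                    (<-≤-trans (Finₚ.toℕ<n i) (m≤m+n p (toℕ a))))
  classify (clique a) (clique b) e = clique-edge a b (+-cancelˡ-< p _ _ (<ᵇ⇒< _ _ (proj₁ (Equivalence.to T-∧ e))))

  edge-kind : ∀ e → OrderedEdge (splitAt p (proj₁ (edge G e))) (splitAt p (proj₂ (edge G e)))
  edge-kind e = classify _ _ (subst T (isOrderedEdge≡ _ _) (edge-isOrderedEdge G e))

  ne-join : ne G ≡ pred p + p * q + triangle q
  ne-join = begin
    ne G
      ≡⟨ ne≡∑ G ⟩
    ∑[ x < p + q ] ∑[ y < p + q ] (if isOrderedEdge G x y then 1 else 0)
      ≡⟨ sum-cong-≗ {p + q} (λ x → trans (sum-cong-≗ {p + q} (λ y → cong indicator (isOrderedEdge≡ x y)))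
                                          (∑-splitAt p (count (splitAt p x)))) ⟩
    ∑[ x < p + q ] row (splitAt p x)
      ≡⟨ ∑-splitAt p row ⟩
    ∑[ i < p ] row (path i) + ∑[ a < q ] row (clique a)
      ≡⟨ cong₂ _+_ (trans (∑-distrib-+ {p} _ _) (cong₂ _+_ path-path path-clique))
                   (trans (∑-distrib-+ {q} _ _) (cong₂ _+_ clique-path clique-clique)) ⟩
    pred p + p * q + (0 + triangle q) ∎
    where
    open ≡-Reasoning
    indicator : Bool → ℕ
    indicator b = if b then 1 else 0
    count : Node → Node → ℕ
    count u v = indicator (isOrderedJoinEdge u v)
    row : Node → ℕ
    row u = ∑[ j < p ] count u (path j) + ∑[ b < q ] count u (clique b)
    path-path : ∑[ i < p ] ∑[ j < p ] count (path i) (path j) ≡ pred p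
    path-path = begin
      ∑[ i < p ] ∑[ j < p ] count (path i) (path j)
        ≡⟨ sum-cong-≗ {p} (λ i → trans (sum-cong-≗ {p} (λ j → cong indicator (<ᵇ∧adjacent (toℕ i) (toℕ j))))
                                        (∑-δ {p} (suc (toℕ i)) (λ _ → 1))) ⟩
      ∑[ i < p ] (if suc (toℕ i) <ᵇ p then 1 else 0)
        ≡⟨ sum-cong-≗ {p} (λ i → cong indicator (suc-<ᵇ (toℕ i) p)) ⟩
      ∑[ i < p ] (if toℕ i <ᵇ pred p then 1 else 0)
        ≡⟨ ∑-<ᵇ {p} (pred p) pred[n]≤n ⟩
      pred p ∎
    path-clique : ∑[ i < p ] ∑[ b < q ] count (path i) (clique b) ≡ p * q
    path-clique = begin
      ∑[ i < p ] ∑[ b < q ] count (path i) (clique b)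
        ≡⟨ sum-cong-≗ {p} (λ i → sum-cong-≗ {q} (λ b → cong (λ c → indicator (c ∧ true))
                                                    (<ᵇ-true (<-≤-trans (Finₚ.toℕ<n i) (m≤m+n p (toℕ b)))))) ⟩
      ∑[ i < p ] ∑[ b < q ] 1
        ≡⟨ trans (sum-cong-≗ {p} (λ _ → trans (∑-const q 1) (*-identityʳ q))) (∑-const p q) ⟩
      p * q ∎
    clique-path : ∑[ a < q ] ∑[ j < p ] count (clique a) (path j) ≡ 0
    clique-path = begin
      ∑[ a < q ] ∑[ j < p ] count (clique a) (path j)
        ≡⟨ sum-cong-≗ {q} (λ a → sum-cong-≗ {p} (λ j → cong (λ c → indicator (c ∧ true))
                                              (<ᵇ-false (≤-trans (<⇒≤ (Finₚ.toℕ<n j)) (m≤m+n p (toℕ a)))))) ⟩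
      ∑[ a < q ] ∑[ j < p ] 0
        ≡⟨ trans (sum-cong-≗ {q} (λ _ → trans (∑-const p 0) (*-zeroʳ p)))
                 (trans (∑-const q 0) (*-zeroʳ q)) ⟩
      0 ∎
    clique-clique : ∑[ a < q ] ∑[ b < q ] count (clique a) (clique b) ≡ triangle q
    clique-clique = begin
      ∑[ a < q ] ∑[ b < q ] count (clique a) (clique b)
        ≡⟨ sum-cong-≗ {q} (λ a → sum-cong-≗ {q} (λ b → cong indicator
             (trans (cong (_∧ not (toℕ a ≡ᵇ toℕ b)) (+-<ᵇ p (toℕ a) (toℕ b))) (<ᵇ∧≢ᵇ (toℕ a) (toℕ b))))) ⟩
      ∑[ a < q ] ∑[ b < q ] (if toℕ a <ᵇ toℕ b then 1 else 0)
        ≡⟨ ∑-comm {q} {q} (λ a b → if toℕ a <ᵇ toℕ b then 1 else 0) ⟩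
      ∑[ b < q ] ∑[ a < q ] (if toℕ a <ᵇ toℕ b then 1 else 0)
        ≡⟨ sum-cong-≗ {q} (λ b → ∑-<ᵇ {q} (toℕ b) (<⇒≤ (Finₚ.toℕ<n b))) ⟩
      ∑[ b < q ] toℕ b
        ≡⟨ ∑-toℕ q ⟩
      triangle q ∎

  nbrSum : (Node → Node → ℕ) → Node → ℕ
  nbrSum L u = ∑[ j < p ] (if joinAdj u (path j) then L u (path j) else 0)
             + ∑[ b < q ] (if joinAdj u (clique b) then L u (clique b) else 0)

  splitAt-injective : Injective _≡_ _≡_ (splitAt p {q})
  splitAt-injective {x} {y} eq =
    trans (sym (Finₚ.join-splitAt p q x)) (trans (cong (Fin.join p q) eq) (Finₚ.join-splitAt p q y))

  labeling-from-edge-labels : (L : Node → Node → ℕ) → (∀ u v → L u v ≡ L v u) →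
    (∀ {u v} → OrderedEdge u v → 0 < L u v × L u v ≤ pred p + p * q + triangle q) →
    (∀ {u v u′ v′} → OrderedEdge u v → OrderedEdge u′ v′ → L u v ≡ L u′ v′ → u ≡ u′ × v ≡ v′) →
    Σ (Labeling G) λ f → ∀ x → vsum G f x ≡ nbrSum L (splitAt p x)
  labeling-from-edge-labels L L-sym L-range L-injective = f , vsum≡nbrSum
    where
    L′ : Fin (p + q) → Fin (p + q) → ℕ
    L′ x y = L (splitAt p x) (splitAt p y)
    ℓ : Fin (ne G) → ℕ
    ℓ e = L′ (proj₁ (edge G e)) (proj₂ (edge G e))
    ℓ-injective : Injective _≡_ _≡_ ℓ
    ℓ-injective {e} {e′} eq with L-injective (edge-kind e) (edge-kind e′) eq
    ... | u≡u′ , v≡v′ = edge-injective G (cong₂ _,_ (splitAt-injective u≡u′) (splitAt-injective v≡v′))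
    labeling : Σ (Labeling G) λ f → ∀ e → label G f e ≡ ℓ e
    labeling = labeling-from-injection G ℓ (proj₁ ∘ L-range ∘ edge-kind)
                 (λ e → subst (ℓ e ≤_) (sym ne-join) (proj₂ (L-range (edge-kind e)))) ℓ-injective
    f : Labeling G
    f = proj₁ labeling
    vsum≡nbrSum : ∀ x → vsum G f x ≡ nbrSum L (splitAt p x)
    vsum≡nbrSum x = begin
      vsum G f x
        ≡⟨ vsum≡∑-neighbours G adj-sym adj-irrefl f L′ (λ x y → L-sym (splitAt p x) (splitAt p y)) (proj₂ labeling) x ⟩
      ∑[ y < p + q ] (if adj G x y then L′ x y else 0)
        ≡⟨ sum-cong-≗ {p + q} (λ y → cong (λ b → if b then L′ x y else 0) (adj≡joinAdj x y)) ⟩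
      ∑[ y < p + q ] (if joinAdj (splitAt p x) (splitAt p y) then L′ x y else 0)
        ≡⟨ ∑-splitAt p (λ v → if joinAdj (splitAt p x) v then L (splitAt p x) v else 0) ⟩
      nbrSum L (splitAt p x) ∎
      where open ≡-Reasoning

  q+2≤numColors : ∀ i j → pathAdj i j ≡ true →
                  (f : Labeling G) → IsLocalAntimagic G f → q + 2 ≤ numColors G f
  q+2≤numColors i j ij-adj f f-antimagic =
    subst (_≤ numColors G f) size (clique≤numColors G f f-antimagic (map vertex nodes) vertices-clique)
    where
    nodes : List Node
    nodes = path i ∷ path j ∷ map clique (allFin q)
    cliques-adjacent : AllPairs (λ u v → joinAdj u v ≡ true) (map clique (allFin q))
    cliques-adjacent = AllPairsₚ.map⁺ (AllPairs.map (λ a≢b → cong not (≡ᵇ-false (a≢b ∘ Finₚ.toℕ-injective)))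
                                                     (Uniqueₚ.allFin⁺ q))
    path-to-cliques : All (λ v → joinAdj (path i) v ≡ true) (map clique (allFin q))
    path-to-cliques = Allₚ.map⁺ (Allₚ.tabulate⁺ (λ _ → refl))
    nodes-clique : AllPairs (λ u v → joinAdj u v ≡ true) nodes
    nodes-clique = (ij-adj All.∷ path-to-cliques) ∷ Allₚ.map⁺ (Allₚ.tabulate⁺ (λ _ → refl)) ∷ cliques-adjacent
    vertices-clique : AllPairs (λ x y → adj G x y ≡ true) (map vertex nodes)
    vertices-clique = AllPairsₚ.map⁺ (AllPairs.map (λ {u} {v} uv → trans (adj-vertex u v) uv) nodes-clique)
    size : length (map vertex nodes) ≡ q + 2
    size = trans (Listₚ.length-map vertex nodes)
                 (trans (cong (2 +_) (length-map-allFin clique)) (+-comm 2 q))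

-- A labeling of P_p ∨ K_q with q + 2 colours for even p, q ≥ 2

module Construction (k l : ℕ) where

  p q : ℕ
  p = suc k * 2
  q = suc l * 2

  open Join p q

  mirror : ℕ → ℕ
  mirror i = p ∸ suc i

  mirror<p : ∀ i → mirror i < p
  mirror<p i = s≤s (m∸n≤m (pred p) i)

  mirror-injective : ∀ {i j} → i < p → j < p → mirror i ≡ mirror j → i ≡ j
  mirror-injective i<p j<p eq = suc-injective (∸-cancelˡ-≡ i<p j<p eq)

  +mirror : ∀ {i} → i < p → i + mirror i ≡ pred p
  +mirror (s≤s i≤pred-p) = m+[n∸m]≡n i≤pred-p

  twice : Parity → ℕ
  twice 0ℙ = 0
  twice 1ℙ = 2

  -- On [0, p) the permutation shift fixes the odd numbers and moves each even number down by two,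
  -- cyclically (0 ↦ p - 2).
  shift : ℕ → ℕ
  shift zero    = k * 2
  shift (suc i) = stepBack (parity i)
    where
    stepBack : Parity → ℕ
    stepBack 0ℙ = suc i
    stepBack 1ℙ = pred i

  shift-suc : ∀ i → shift (suc i) + twice (parity i) ≡ suc i
  shift-suc i with parity i in parity-i
  shift-suc i       | 0ℙ = +-identityʳ (suc i)
  shift-suc (suc i) | 1ℙ = +-comm i 2

  parity-*2 : ∀ n → parity (n * 2) ≡ 0ℙ
  parity-*2 zero    = refl
  parity-*2 (suc n) = parity-*2 n

  parity-shift : ∀ i → parity (shift i) ≡ parity i
  parity-shift zero    = parity-*2 k
  parity-shift (suc i) = sym (begin
    parity (suc i)                                          ≡⟨ cong parity (shift-suc i) ⟨
    parity (shift (suc i) + twice (parity i))               ≡⟨ Parityₚ.+-homo-+ (shift (suc i)) (twice (parity i)) ⟩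
    parity (shift (suc i)) ℙ.+ parity (twice (parity i))    ≡⟨ cong (parity (shift (suc i)) ℙ.+_) (parity-twice (parity i)) ⟩
    parity (shift (suc i)) ℙ.+ 0ℙ                           ≡⟨ Parityₚ.+-identityʳ _ ⟩
    parity (shift (suc i))                                  ∎)
    where
    open ≡-Reasoning
    parity-twice : ∀ π → parity (twice π) ≡ 0ℙ
    parity-twice 0ℙ = refl
    parity-twice 1ℙ = refl

  shift<p : ∀ {i} → i < p → shift i < p
  shift<p {zero}  _     = m<n⇒m<1+n (n<1+n (k * 2))
  shift<p {suc i} 1+i<p = ≤-<-trans (subst (shift (suc i) ≤_) (shift-suc i) (m≤m+n _ _)) 1+i<p

  shift-injective : ∀ {i j} → i < p → j < p → shift i ≡ shift j → i ≡ j
  shift-injective {zero}  {zero}  _ _ _ = refl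
  shift-injective {zero}  {suc j} _ 1+j<p eq = ⊥-elim (<-irrefl 1+j≡p 1+j<p)
    where
    parity-j : parity j ≡ 1ℙ
    parity-j = trans (sym (Parityₚ.suc-homo-⁻¹ j))
                     (cong ℙ._⁻¹ (trans (sym (parity-shift (suc j))) (trans (sym (cong parity eq)) (parity-*2 k))))
    1+j≡p : suc j ≡ p
    1+j≡p = trans (sym (shift-suc j)) (trans (cong₂ _+_ (sym eq) (cong twice parity-j)) (+-comm (k * 2) 2))
  shift-injective {suc i} {zero}  1+i<p j<p eq = sym (shift-injective j<p 1+i<p (sym eq))
  shift-injective {suc i} {suc j} _ _ eq = begin
    suc i                                   ≡⟨ shift-suc i ⟨
    shift (suc i) + twice (parity i)        ≡⟨ cong₂ _+_ eq (cong twice same-parity) ⟩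
    shift (suc j) + twice (parity j)        ≡⟨ shift-suc j ⟩
    suc j                                   ∎
    where
    open ≡-Reasoning
    same-parity : parity i ≡ parity j
    same-parity = trans (sym (Parityₚ.suc-homo-⁻¹ i))
      (trans (cong ℙ._⁻¹ (trans (sym (parity-shift (suc i))) (trans (cong parity eq) (parity-shift (suc j)))))
             (Parityₚ.suc-homo-⁻¹ j))

  twist : ℕ → ℕ → ℕ
  twist zero          i = i
  twist (suc zero)    i = mirror i
  twist (suc (suc a)) i = twist a i

  σ : ℕ → ℕ → ℕ
  σ zero          i = i
  σ (suc zero)    i = shift i
  σ (suc (suc a)) i = twist a i

  twist<p : ∀ a {i} → i < p → twist a i < p
  twist<p zero          i<p = i<p
  twist<p (suc zero)    {i} _ = mirror<p i
  twist<p (suc (suc a)) i<p = twist<p a i<p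

  twist-injective : ∀ a {i j} → i < p → j < p → twist a i ≡ twist a j → i ≡ j
  twist-injective zero          _   _   eq = eq
  twist-injective (suc zero)    i<p j<p eq = mirror-injective i<p j<p eq
  twist-injective (suc (suc a)) i<p j<p eq = twist-injective a i<p j<p eq

  σ<p : ∀ a {i} → i < p → σ a i < p
  σ<p zero          i<p = i<p
  σ<p (suc zero)    i<p = shift<p i<p
  σ<p (suc (suc a)) i<p = twist<p a i<p

  σ-injective : ∀ a {i j} → i < p → j < p → σ a i ≡ σ a j → i ≡ j
  σ-injective zero          _   _   eq = eq
  σ-injective (suc zero)    i<p j<p eq = shift-injective i<p j<p eq
  σ-injective (suc (suc a)) i<p j<p eq = twist-injective a i<p j<p eq

  ∑-twist : ∀ m {i} → i < p → ∑[ a < m * 2 ] twist (toℕ a) i ≡ m * pred p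
  ∑-twist zero    _       = refl
  ∑-twist (suc m) {i} i<p = trans (sym (+-assoc i (mirror i) _)) (cong₂ _+_ (+mirror i<p) (∑-twist m i<p))

  ∑-σ : ∀ {i} → i < p → ∑[ a < q ] σ (toℕ a) i ≡ i + shift i + l * pred p
  ∑-σ {i} i<p = trans (cong (λ s → i + (shift i + s)) (∑-twist l i<p)) (sym (+-assoc i (shift i) _))

  -- The labels fall into three consecutive blocks: the path edge {i, i+1} gets p - (i + 1) ∈ [1, p),
  -- the join edge {i, a} gets p (1 + a) + σ a i ∈ [p, c₀) with σ a a permutation of [0, p),
  -- and the clique edge {a, b} with a < b gets c₀ + triangle b + a, numbering the pairs a < b.
  c₀ : ℕ
  c₀ = p + p * q

  pathLabel joinLabel cliqueLabel : ℕ → ℕ → ℕ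
  pathLabel   i j = p ∸ suc (i ℕ.⊓ j)
  joinLabel   i a = p + p * a + σ a i
  cliqueLabel a b = c₀ + triangle (a ℕ.⊔ b) + a ℕ.⊓ b

  edgeLabel : Node → Node → ℕ
  edgeLabel (path i)   (path j)   = pathLabel (toℕ i) (toℕ j)
  edgeLabel (path i)   (clique a) = joinLabel (toℕ i) (toℕ a)
  edgeLabel (clique a) (path i)   = joinLabel (toℕ i) (toℕ a)
  edgeLabel (clique a) (clique b) = cliqueLabel (toℕ a) (toℕ b)

  cliqueLabel-sym : ∀ a b → cliqueLabel a b ≡ cliqueLabel b a
  cliqueLabel-sym a b = cong₂ (λ m n → c₀ + triangle m + n) (⊔-comm a b) (⊓-comm a b)

  edgeLabel-sym : ∀ u v → edgeLabel u v ≡ edgeLabel v u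
  edgeLabel-sym (path i)   (path j)   = cong (λ m → p ∸ suc m) (⊓-comm (toℕ i) (toℕ j))
  edgeLabel-sym (path i)   (clique a) = refl
  edgeLabel-sym (clique a) (path i)   = refl
  edgeLabel-sym (clique a) (clique b) = cliqueLabel-sym (toℕ a) (toℕ b)

  pathLabel-up : ∀ i → pathLabel i (suc i) ≡ mirror i
  pathLabel-up i = cong (λ m → p ∸ suc m) (m≤n⇒m⊓n≡m (n≤1+n i))

  pathLabel-down : ∀ i → pathLabel (suc i) i ≡ mirror i
  pathLabel-down i = cong (λ m → p ∸ suc m) (m≥n⇒m⊓n≡n (n≤1+n i))

  cliqueLabel-< : ∀ {a b} → a < b → cliqueLabel a b ≡ c₀ + triangle b + a
  cliqueLabel-< a<b = cong₂ (λ m n → c₀ + triangle m + n) (m≤n⇒m⊔n≡n (<⇒≤ a<b)) (m≤n⇒m⊓n≡m (<⇒≤ a<b))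

  path-edge-label : ∀ i j → toℕ j ≡ suc (toℕ i) → edgeLabel (path i) (path j) ≡ mirror (toℕ i)
  path-edge-label i j j≡1+i = trans (cong (pathLabel (toℕ i)) j≡1+i) (pathLabel-up (toℕ i))

  joinLabel<c₀ : ∀ (i : Fin p) (a : Fin q) → joinLabel (toℕ i) (toℕ a) < c₀
  joinLabel<c₀ i a = subst (_< c₀) (sym (+-assoc p _ _))
    (+-monoʳ-< p (subst (p * toℕ a + σ (toℕ a) (toℕ i) <_) (+-identityʳ (p * q))
                        (*+<*+ p (σ<p (toℕ a) (Finₚ.toℕ<n i)) (Finₚ.toℕ<n a))))

  c₀≤clique : ∀ a b → c₀ ≤ cliqueLabel a b
  c₀≤clique a b = ≤-trans (m≤m+n c₀ _) (m≤m+n _ _)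

  path<join : ∀ {i j} i′ a′ → toℕ j ≡ suc (toℕ i) →
              edgeLabel (path i) (path j) < edgeLabel (path i′) (clique a′)
  path<join {i} {j} i′ a′ j≡1+i = subst (_< joinLabel (toℕ i′) (toℕ a′)) (sym (path-edge-label i j j≡1+i))
    (<-≤-trans (mirror<p (toℕ i)) (≤-trans (m≤m+n p _) (m≤m+n _ _)))

  join<clique : ∀ i a a′ b′ → edgeLabel (path i) (clique a) < edgeLabel (clique a′) (clique b′)
  join<clique i a a′ b′ = <-≤-trans (joinLabel<c₀ i a) (c₀≤clique (toℕ a′) (toℕ b′))

  path<clique : ∀ {i j} a′ b′ → toℕ j ≡ suc (toℕ i) →
                edgeLabel (path i) (path j) < edgeLabel (clique a′) (clique b′)
  path<clique {i} a′ b′ j≡1+i = <-trans (path<join i Fin.zero j≡1+i) (join<clique i Fin.zero a′ b′)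

  edgeLabel-range : ∀ {u v} → OrderedEdge u v → 0 < edgeLabel u v × edgeLabel u v ≤ pred p + p * q + triangle q
  edgeLabel-range (path-edge i j j≡1+i) rewrite path-edge-label i j j≡1+i =
    m<n⇒0<n∸m (subst (_< p) j≡1+i (Finₚ.toℕ<n j)) ,
    ≤-trans (<⇒≤pred (mirror<p (toℕ i))) (≤-trans (m≤m+n (pred p) (p * q)) (m≤m+n _ (triangle q)))
  edgeLabel-range (join-edge i a) = z<s , ≤-trans (<⇒≤pred (joinLabel<c₀ i a)) (m≤m+n _ (triangle q))
  edgeLabel-range (clique-edge a b a<b) rewrite cliqueLabel-< a<b =
    z<s , subst (_< pred p + p * q + triangle q) (sym (+-assoc (pred p + p * q) _ (toℕ a)))
                (+-monoʳ-< (pred p + p * q) (triangle+<triangle a<b (Finₚ.toℕ<n b)))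

  edgeLabel-injective : ∀ {u v u′ v′} → OrderedEdge u v → OrderedEdge u′ v′ →
                        edgeLabel u v ≡ edgeLabel u′ v′ → u ≡ u′ × v ≡ v′
  edgeLabel-injective (path-edge i j e) (path-edge i′ j′ e′) eq
    with Finₚ.toℕ-injective {i = i} {i′} (mirror-injective (Finₚ.toℕ<n i) (Finₚ.toℕ<n i′)
           (trans (sym (path-edge-label i j e)) (trans eq (path-edge-label i′ j′ e′))))
  ... | refl = refl , cong path (Finₚ.toℕ-injective (trans e (sym e′)))
  edgeLabel-injective (join-edge i a) (join-edge i′ a′) eq
    with *+-injective p (σ<p (toℕ a) (Finₚ.toℕ<n i)) (σ<p (toℕ a′) (Finₚ.toℕ<n i′))
           (+-cancelˡ-≡ p _ _ (trans (sym (+-assoc p _ _)) (trans eq (+-assoc p _ _))))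
  ... | a≡a′ , σ≡σ with Finₚ.toℕ-injective {i = a} {a′} a≡a′
  ...   | refl =
    cong path (Finₚ.toℕ-injective (σ-injective (toℕ a) (Finₚ.toℕ<n i) (Finₚ.toℕ<n i′) σ≡σ)) , refl
  edgeLabel-injective (clique-edge a b a<b) (clique-edge a′ b′ a′<b′) eq
    with triangle-pair-injective a<b a′<b′ (+-cancelˡ-≡ c₀ _ _
           (trans (sym (+-assoc c₀ _ _))
             (trans (sym (cliqueLabel-< a<b)) (trans eq (trans (cliqueLabel-< a′<b′) (+-assoc c₀ _ _))))))
  ... | a≡a′ , b≡b′ = cong clique (Finₚ.toℕ-injective a≡a′) , cong clique (Finₚ.toℕ-injective b≡b′)
  edgeLabel-injective (path-edge _ _ e)   (join-edge i′ a′)     eq = ⊥-elim (<-irrefl eq (path<join i′ a′ e))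
  edgeLabel-injective (path-edge _ _ e)   (clique-edge a′ b′ _) eq = ⊥-elim (<-irrefl eq (path<clique a′ b′ e))
  edgeLabel-injective (join-edge i a)     (path-edge _ _ e′)    eq = ⊥-elim (<-irrefl (sym eq) (path<join i a e′))
  edgeLabel-injective (join-edge i a)     (clique-edge a′ b′ _) eq = ⊥-elim (<-irrefl eq (join<clique i a a′ b′))
  edgeLabel-injective (clique-edge a b _) (path-edge _ _ e′)    eq = ⊥-elim (<-irrefl (sym eq) (path<clique a b e′))
  edgeLabel-injective (clique-edge a b _) (join-edge i′ a′)     eq = ⊥-elim (<-irrefl (sym eq) (join<clique i′ a′ a b))

  labeling : Σ (Labeling G) λ f → ∀ x → vsum G f x ≡ nbrSum edgeLabel (splitAt p x)
  labeling = labeling-from-edge-labels edgeLabel edgeLabel-sym edgeLabel-range edgeLabel-injective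

  pathPart : ℕ → ℕ
  pathPart i = ∑[ j < p ] (if (suc i ≡ᵇ toℕ j) ∨ (suc (toℕ j) ≡ᵇ i) then pathLabel i (toℕ j) else 0)

  up down : ℕ → ℕ → ℕ
  up   i j = if suc i ≡ᵇ j then pathLabel i j else 0
  down i j = if suc j ≡ᵇ i then pathLabel i j else 0

  pathPart-up : ∀ i → ∑[ j < p ] up i (toℕ j) ≡ mirror i
  pathPart-up i with suc i <? p
  ... | yes 1+i<p rewrite ∑-δ {p} (suc i) (pathLabel i) | <ᵇ-true 1+i<p = pathLabel-up i
  ... | no  1+i≮p rewrite ∑-δ {p} (suc i) (pathLabel i) | <ᵇ-false (≮⇒≥ 1+i≮p) =
    sym (m≤n⇒m∸n≡0 (≮⇒≥ 1+i≮p))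

  pathPart-down : ∀ {i} → i < p → ∑[ j < p ] down (suc i) (toℕ j) ≡ mirror i
  pathPart-down {i} i<p = begin
    ∑[ j < p ] (if toℕ j ≡ᵇ i then pathLabel (suc i) (toℕ j) else 0)
      ≡⟨ sum-cong-≗ {p} (λ j → cong (λ b → if b then pathLabel (suc i) (toℕ j) else 0) (≡ᵇ-sym (toℕ j) i)) ⟩
    ∑[ j < p ] (if i ≡ᵇ toℕ j then pathLabel (suc i) (toℕ j) else 0)
      ≡⟨ ∑-δ {p} i (pathLabel (suc i)) ⟩
    (if i <ᵇ p then pathLabel (suc i) i else 0)
      ≡⟨ cong (λ b → if b then pathLabel (suc i) i else 0) (<ᵇ-true i<p) ⟩
    pathLabel (suc i) i
      ≡⟨ pathLabel-down i ⟩
    mirror i ∎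
    where open ≡-Reasoning

  pathPart-split : ∀ i → pathPart i ≡ ∑[ j < p ] up i (toℕ j) + ∑[ j < p ] down i (toℕ j)
  pathPart-split i = trans (sum-cong-≗ {p} (λ j → if-∨-split true _ _ (pathLabel i (toℕ j)) (λ _ → not-both (toℕ j))))
                           (∑-distrib-+ {p} (up i ∘ toℕ) (down i ∘ toℕ))
    where
    not-both : ∀ j → T (suc i ≡ᵇ j) → T (suc j ≡ᵇ i) → ⊥
    not-both j i+1≡j j+1≡i with ≡ᵇ⇒≡ (suc i) j i+1≡j | ≡ᵇ⇒≡ (suc j) i j+1≡i
    ... | refl | 2+i≡i = <-irrefl (sym 2+i≡i) (m<n⇒m<1+n (n<1+n i))

  pathPart-zero : pathPart 0 ≡ pred p
  pathPart-zero =
    trans (pathPart-split 0) (trans (cong₂ _+_ (pathPart-up 0) (∑-if {p} false (λ _ → 0))) (+-identityʳ (pred p)))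

  -- pathPart i + 2 i = 2 p - 1 for 0 < i < p and shift subtracts 2 exactly at the even i > 0,
  -- while the wrap-around value shift 0 = p - 2 brings i = 0 to the same total as the other even i.
  pathPart+i+shift : ∀ {i} → i < p → pathPart i + i + shift i + twice (parity i ℙ.⁻¹) ≡ pred p + p
  pathPart+i+shift {zero} _ = trans (cong (λ s → s + 0 + k * 2 + 2) pathPart-zero) (add-two (pred p) (k * 2))
    where
    add-two : ∀ x y → x + 0 + y + 2 ≡ x + suc (suc y)
    add-two = solve-∀
  pathPart+i+shift {suc i} 1+i<p = begin
    pathPart (suc i) + suc i + shift (suc i) + twice (parity (suc i) ℙ.⁻¹)
      ≡⟨ cong₂ (λ s π → s + suc i + shift (suc i) + twice π)
               (trans (pathPart-split (suc i)) (cong₂ _+_ (pathPart-up (suc i)) (pathPart-down (<-trans (n<1+n i) 1+i<p))))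
               (Parityₚ.suc-homo-⁻¹ i) ⟩
    mirror (suc i) + mirror i + suc i + shift (suc i) + twice (parity i)
      ≡⟨ regroup (mirror (suc i)) (mirror i) (suc i) (shift (suc i)) (twice (parity i)) ⟩
    (mirror (suc i) + suc i) + (mirror i + (shift (suc i) + twice (parity i)))
      ≡⟨ cong₂ _+_ (m∸n+n≡m (<⇒≤pred 1+i<p)) (cong (mirror i +_) (shift-suc i)) ⟩
    pred p + (mirror i + suc i)
      ≡⟨ cong (pred p +_) (m∸n+n≡m (<⇒≤ 1+i<p)) ⟩
    pred p + p ∎
    where
    open ≡-Reasoning
    regroup : ∀ a b c d e → a + b + c + d + e ≡ (a + c) + (b + (d + e))
    regroup = solve-∀

  W : ℕ
  W = ∑[ a < q ] (p + p * toℕ a)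

  pathColour : Parity → ℕ
  pathColour 0ℙ = W + l * pred p + (pred p + k * 2)
  pathColour 1ℙ = W + l * pred p + (pred p + p)

  pathColour+twice : ∀ π → pathColour π + twice (π ℙ.⁻¹) ≡ W + l * pred p + (pred p + p)
  pathColour+twice 0ℙ = add-two (W + l * pred p) (pred p) (k * 2)
    where
    add-two : ∀ w x y → w + (x + y) + 2 ≡ w + (x + suc (suc y))
    add-two = solve-∀
  pathColour+twice 1ℙ = +-identityʳ _

  nbrSum-path : ∀ i → nbrSum edgeLabel (path i) ≡ pathColour (parity (toℕ i))
  nbrSum-path i = +-cancelʳ-≡ (twice (π ℙ.⁻¹)) _ _ (begin
    pathPart n + ∑[ a < q ] joinLabel n (toℕ a) + twice (π ℙ.⁻¹)
      ≡⟨ cong (λ s → pathPart n + s + twice (π ℙ.⁻¹))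
              (trans (∑-distrib-+ {q} (λ a → p + p * toℕ a) (λ a → σ (toℕ a) n)) (cong (W +_) (∑-σ (Finₚ.toℕ<n i)))) ⟩
    pathPart n + (W + (n + shift n + l * pred p)) + twice (π ℙ.⁻¹)
      ≡⟨ regroup (pathPart n) W n (shift n) (l * pred p) (twice (π ℙ.⁻¹)) ⟩
    W + l * pred p + (pathPart n + n + shift n + twice (π ℙ.⁻¹))
      ≡⟨ cong (W + l * pred p +_) (pathPart+i+shift (Finₚ.toℕ<n i)) ⟩
    W + l * pred p + (pred p + p)
      ≡⟨ pathColour+twice π ⟨
    pathColour π + twice (π ℙ.⁻¹) ∎)
    where
    open ≡-Reasoning
    n : ℕ
    n = toℕ i
    π : Parity
    π = parity n
    regroup : ∀ P w n s m t → P + (w + (n + s + m)) + t ≡ w + m + (P + n + s + t)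
    regroup = solve-∀

  colSum : ℕ → ℕ
  colSum a = ∑[ j < p ] joinLabel (toℕ j) a

  cliqueTerm : Fin q → Fin q → ℕ
  cliqueTerm a b = if not (toℕ a ≡ᵇ toℕ b) then cliqueLabel (toℕ a) (toℕ b) else 0

  cliquePart : Fin q → ℕ
  cliquePart a = ∑[ b < q ] cliqueTerm a b

  cliqueColour : Fin q → ℕ
  cliqueColour a = colSum (toℕ a) + cliquePart a

  colSum-lower : ∀ a → p * (p + p * a) ≤ colSum a
  colSum-lower a = subst (_≤ colSum a) (∑-const p (p + p * a)) (∑-mono-≤ {p} (λ j → m≤m+n (p + p * a) (σ a (toℕ j))))

  colSum-upper : ∀ a → colSum a < p * (p + p * suc a)
  colSum-upper a = begin-strict
    colSum a                         ≤⟨ ∑-mono-≤ {p} (λ j → +-monoʳ-≤ (p + p * a) (<⇒≤pred (σ<p a (Finₚ.toℕ<n j)))) ⟩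
    ∑[ j < p ] (p + p * a + pred p)  ≡⟨ ∑-const p (p + p * a + pred p) ⟩
    p * (p + p * a + pred p)         <⟨ *-monoʳ-< p (+-monoʳ-< (p + p * a) ≤-refl) ⟩
    p * (p + p * a + p)              ≡⟨ cong (p *_) (step p a) ⟩
    p * (p + p * suc a)              ∎
    where
    open ≤-Reasoning
    step : ∀ p a → p + p * a + p ≡ p + p * suc a
    step = solve-∀

  colSum-mono : ∀ {a b} → a < b → colSum a < colSum b
  colSum-mono {a} {b} a<b =
    <-≤-trans (colSum-upper a) (≤-trans (*-monoʳ-≤ p (+-monoʳ-≤ p (*-monoʳ-≤ p a<b))) (colSum-lower b))

  cliqueLabel-mono : ∀ {a b} c → a ≤ b → cliqueLabel a c ≤ cliqueLabel b c
  cliqueLabel-mono c a≤b = +-mono-≤ (+-monoʳ-≤ c₀ (triangle-mono-≤ (⊔-monoˡ-≤ c a≤b))) (⊓-monoˡ-≤ c a≤b)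

  cliquePart-lower : ∀ a → pred q * c₀ ≤ cliquePart a
  cliquePart-lower a =
    subst (_≤ cliquePart a) others (∑-mono-≤ {q} (λ b → at-least {toℕ b} (toℕ a ≡ᵇ toℕ b)))
    where
    at-least : ∀ {b} x → (if not x then c₀ else 0) ≤ (if not x then cliqueLabel (toℕ a) b else 0)
    at-least true  = z≤n
    at-least false = c₀≤clique _ _
    others : ∑[ b < q ] (if not (toℕ a ≡ᵇ toℕ b) then c₀ else 0) ≡ pred q * c₀
    others = +-cancelʳ-≡ c₀ _ _
      (trans (trans (∑-remove a (λ _ → c₀)) (∑-const q c₀)) (+-comm c₀ (pred q * c₀)))

  cliqueTerm-≢ : ∀ {a b} → toℕ a ≢ toℕ b → cliqueTerm a b ≡ cliqueLabel (toℕ a) (toℕ b)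
  cliqueTerm-≢ {a} {b} a≢b = cong (λ x → if not x then cliqueLabel (toℕ a) (toℕ b) else 0) (≡ᵇ-false a≢b)

  cliquePart-mono : ∀ {a b} → toℕ a < toℕ b → cliquePart a ≤ cliquePart b
  cliquePart-mono {a} {b} a<b = begin
    cliquePart a
      ≡⟨ ∑-remove b (cliqueTerm a) ⟨
    ∑[ c < q ] (if not (toℕ b ≡ᵇ toℕ c) then cliqueTerm a c else 0) + cliqueTerm a b
      ≤⟨ +-mono-≤ (∑-mono-≤ {q} (λ c → if-if-mono (not (toℕ b ≡ᵇ toℕ c)) (not (toℕ a ≡ᵇ toℕ c))
                                                    (cliqueLabel-mono (toℕ c) (<⇒≤ a<b))))
                  (≤-reflexive (trans (cliqueTerm-≢ (<⇒≢ a<b))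
                                      (trans (cliqueLabel-sym (toℕ a) (toℕ b)) (sym (cliqueTerm-≢ (>⇒≢ a<b)))))) ⟩
    ∑[ c < q ] (if not (toℕ a ≡ᵇ toℕ c) then cliqueTerm b c else 0) + cliqueTerm b a
      ≡⟨ ∑-remove a (cliqueTerm b) ⟩
    cliquePart b ∎
    where open ≤-Reasoning

  cliqueColour-mono : ∀ {a b} → toℕ a < toℕ b → cliqueColour a < cliqueColour b
  cliqueColour-mono a<b = +-mono-<-≤ (colSum-mono a<b) (cliquePart-mono a<b)

  cliqueColour-injective : Injective _≡_ _≡_ cliqueColour
  cliqueColour-injective {a} {b} eq with <-cmp (toℕ a) (toℕ b)
  ... | tri< a<b _ _ = ⊥-elim (<-irrefl eq (cliqueColour-mono a<b))
  ... | tri≈ _ a≡b _ = Finₚ.toℕ-injective a≡b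
  ... | tri> _ _ b<a = ⊥-elim (<-irrefl (sym eq) (cliqueColour-mono b<a))

  W≡ : W ≡ q * p + p * triangle q
  W≡ = begin
    ∑[ a < q ] (p + p * toℕ a)            ≡⟨ ∑-distrib-+ {q} (λ _ → p) (λ a → p * toℕ a) ⟩
    ∑[ a < q ] p + ∑[ a < q ] (p * toℕ a) ≡⟨ cong₂ _+_ (∑-const q p) (sym (*-distribˡ-sum {q} p toℕ)) ⟩
    q * p + p * ∑[ a < q ] toℕ a          ≡⟨ cong (λ t → q * p + p * t) (∑-toℕ q) ⟩
    q * p + p * triangle q                ∎
    where open ≡-Reasoning

  pathColour<bound : pathColour 1ℙ < p * p + pred q * c₀
  pathColour<bound = +-cancelʳ-< (p * suc l) _ _ (begin-strict
    pathColour 1ℙ + p * suc l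
      ≡⟨ cong (λ w → w + l * pred p + (pred p + p) + p * suc l) W≡ ⟩
    q * p + p * triangle q + l * pred p + (pred p + p) + p * suc l
      ≡⟨ collect (q * p) p (triangle q) (l * pred p) (pred p + p) (suc l) ⟩
    q * p + p * (triangle q + suc l) + l * pred p + (pred p + p)
      ≡⟨ cong (λ t → q * p + p * t + l * pred p + (pred p + p)) (triangle-*2 (suc l)) ⟩
    q * p + p * (suc l * suc l * 2) + l * pred p + (pred p + p)
      <⟨ m<m+n _ z<s ⟩
    q * p + p * (suc l * suc l * 2) + l * pred p + (pred p + p) + suc (p * (k * 2) + suc l * p * l * 2 + l)
      ≡⟨ balance k l ⟩
    p * p + pred q * c₀ + p * suc l ∎)
    where
    open ≤-Reasoning
    collect : ∀ a p t b c s → a + p * t + b + c + p * s ≡ a + p * (t + s) + b + c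
    collect = solve-∀
    balance : ∀ k l →
      suc l * 2 * (suc k * 2) + suc k * 2 * (suc l * suc l * 2) + l * suc (k * 2) + (suc (k * 2) + suc k * 2)
        + suc (suc k * 2 * (k * 2) + suc l * (suc k * 2) * l * 2 + l)
      ≡ suc k * 2 * (suc k * 2) + suc (l * 2) * (suc k * 2 + suc k * 2 * (suc l * 2)) + suc k * 2 * suc l
    balance = solve-∀

  pathColour-0<1 : pathColour 0ℙ < pathColour 1ℙ
  pathColour-0<1 = +-monoʳ-< (W + l * pred p) (+-monoʳ-< (pred p) (m<n⇒m<1+n (n<1+n (k * 2))))

  pathColour≤ : ∀ π → pathColour π ≤ pathColour 1ℙ
  pathColour≤ 0ℙ = <⇒≤ pathColour-0<1
  pathColour≤ 1ℙ = ≤-refl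

  pathColour-injective : Injective _≡_ _≡_ pathColour
  pathColour-injective {0ℙ} {0ℙ} _  = refl
  pathColour-injective {0ℙ} {1ℙ} eq = ⊥-elim (<-irrefl eq pathColour-0<1)
  pathColour-injective {1ℙ} {0ℙ} eq = ⊥-elim (<-irrefl (sym eq) pathColour-0<1)
  pathColour-injective {1ℙ} {1ℙ} _  = refl

  pathColour<cliqueColour : ∀ π a → pathColour π < cliqueColour a
  pathColour<cliqueColour π a = ≤-<-trans (pathColour≤ π) (<-≤-trans pathColour<bound
    (+-mono-≤ (≤-trans (*-monoʳ-≤ p (m≤m+n p (p * toℕ a))) (colSum-lower (toℕ a))) (cliquePart-lower a)))

  colour : Node → ℕ
  colour (path i)   = pathColour (parity (toℕ i))
  colour (clique a) = cliqueColour a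

  nbrSum≡colour : ∀ u → nbrSum edgeLabel u ≡ colour u
  nbrSum≡colour (path i)   = nbrSum-path i
  nbrSum≡colour (clique a) = refl

  colour-proper : ∀ u v → joinAdj u v ≡ true → colour u ≢ colour v
  colour-proper (path i) (path j) ij-adj eq
    with Equivalence.to (T-∨ {suc (toℕ i) ≡ᵇ toℕ j} {suc (toℕ j) ≡ᵇ toℕ i}) (subst T (sym ij-adj) tt)
  ... | inj₁ j≡1+i = parity-suc≢ (toℕ i)
                       (trans (cong parity (≡ᵇ⇒≡ (suc (toℕ i)) (toℕ j) j≡1+i)) (sym (pathColour-injective eq)))
  ... | inj₂ i≡1+j = parity-suc≢ (toℕ j)
                       (trans (cong parity (≡ᵇ⇒≡ (suc (toℕ j)) (toℕ i) i≡1+j)) (pathColour-injective eq))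
  colour-proper (path i)   (clique a) _ eq = <-irrefl eq (pathColour<cliqueColour (parity (toℕ i)) a)
  colour-proper (clique a) (path i)   _ eq = <-irrefl (sym eq) (pathColour<cliqueColour (parity (toℕ i)) a)
  colour-proper (clique a) (clique b) ab-adj eq with cliqueColour-injective {a} {b} eq
  ... | refl with subst (λ x → not x ≡ true) (≡ᵇ-refl (toℕ a)) ab-adj
  ...   | ()

  f₀ : Labeling G
  f₀ = proj₁ labeling

  vsum-f₀ : ∀ x → vsum G f₀ x ≡ colour (splitAt p x)
  vsum-f₀ x = trans (proj₂ labeling x) (nbrSum≡colour (splitAt p x))

  f₀-antimagic : IsLocalAntimagic G f₀
  f₀-antimagic x y xy-adj eq = colour-proper (splitAt p x) (splitAt p y) (trans (sym (adj≡joinAdj x y)) xy-adj)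
                                             (trans (sym (vsum-f₀ x)) (trans eq (vsum-f₀ y)))

  colours : List ℕ
  colours = pathColour 0ℙ ∷ pathColour 1ℙ ∷ map cliqueColour (allFin q)

  colour∈colours : ∀ u → colour u ∈ colours
  colour∈colours (path i) with parity (toℕ i)
  ... | 0ℙ = here refl
  ... | 1ℙ = there (here refl)
  colour∈colours (clique a) = there (there (∈-map⁺ cliqueColour (∈-allFin a)))

  numColors-f₀ : numColors G f₀ ≡ q + 2
  numColors-f₀ = ≤-antisym
    (subst (numColors G f₀ ≤_) (trans (cong (2 +_) (length-map-allFin cliqueColour)) (+-comm 2 q))
           (numColors≤ G f₀ colours (λ x → subst (_∈ colours) (sym (vsum-f₀ x)) (colour∈colours (splitAt p x)))))
    (q+2≤numColors Fin.zero (Fin.suc Fin.zero) refl f₀ f₀-antimagic)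

  χla≡q+2 : ChiLaEq G (q + 2)
  χla≡q+2 = (f₀ , f₀-antimagic , numColors-f₀) , q+2≤numColors Fin.zero (Fin.suc Fin.zero) refl

mainTheorem6 : ∀ (m n : ℕ) → m ≥ 1 → n ≥ 1 →
    ChiLaEq (PathJoinComplete (2 * m) (2 * n)) (2 * n + 2)
mainTheorem6 (suc k) (suc l) _ _ =
  subst₂ (λ p q → ChiLaEq (PathJoinComplete p q) (q + 2)) (*-comm (suc k) 2) (*-comm (suc l) 2)
         (Construction.χla≡q+2 k l)
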